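{- Let $T$ be a Dyck tableau and $\sigma=\phi(T)$. Shadow boxes of $T$ are in bijection with patterns $2^+12$ of $\sigma$. Clear boxes of $T$ are in bijection with patterns $1^+21$ of $\sigma$.
   Context: A Dyck tableau of size $n$ is a Dyck path of size $n$ (the staircase Ferrers diagram $E_n=(n,\dots,1)$ with the boxes of a partition $\mu\subset E_{n-1}$ removed, with $n$ columns) in which each column contains exactly one dot, drawn on a basement of $n+1$ boxes. Every Dyck tableau is built uniquely by successive insertions of dotted boxes: in a tableau of size $k$, one chooses one of the $k+1$ basement boxes (labeled $0,\dots,k$ from left to right), adds a new column with a dot at that place, and, if the new column is to the left of the special box (the right-most dotted box with no box to its South-West; it is always the dot inserted at the previous step), adds a ribbon, i.e. a strip of boxes along the lower border linking the new dot to the special dot, which raises by one box the columns strictly between them. The dot inserted at step $j$ gets label $j$. The bijection $\phi$ maps $T$ to the permutation $\sigma$ whose non-inversion table $NI_\sigma[i]=\#\{j'<j:\ \sigma(j')<\sigma(j)\}$ (with $\sigma(j)=i$) equals the sequence of chosen basement labels. Equivalently, starting from $\sigma$: label the columns from left to right by $\sigma(1),\dots,\sigma(n)$ and, for $j=1,\dots,n$, add a dotted box in the column labeled $j$ and, if it is to the left of the dotted box added at step $j-1$, add a ribbon between these two boxes. In $T$, the boxes below the dot in a column are its shadow boxes and the (empty) boxes above the dot in a column are its clear boxes. A pattern $2^+12$ of $\sigma$ is a sub-word $abc$ with $b<c$ and $a=c+1$; a pattern $1^+21$ of $\sigma$ is a sub-word $abc$ with $a=c+1$ and $b>a$. -}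

module Defs where

open import Data.Nat using (ℕ; zero; suc; _≤_; _<_; _≤?_; _<?_)
open import Data.Nat.Properties using ()
open import Data.Fin using (Fin; toℕ)
import Data.Fin as F
open import Data.Fin.Permutation using (Permutation′; _⟨$⟩ʳ_; _⟨$⟩ˡ_)
open import Data.List using (List; []; _∷_; _++_; take; drop; length; lookup; map; filter; allFin; foldl)
open import Data.Maybe using (Maybe; just; nothing)
open import Data.Product using (Σ; Σ-syntax; _×_)
open import Data.Unit using (⊤)
open import Relation.Nullary using (does)
open import Relation.Nullary.Decidable using (_×-dec_)
open import Data.Bool using (if_then_else_)
open import Relation.Binary.PropositionalEquality using (_≡_)

-- A column of the tableau: its label (the step at which its dot was
-- inserted, 0-based), its number of boxes ('height'), and the row of
-- its dot (rows 0 .. height-1 counted upwards from the lower border).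

record Column : Set where
  constructor column
  field
    label  : ℕ
    height : ℕ
    dotRow : ℕ
open Column public

-- A tableau of size k: its k columns from left to right, the heights of
-- the Dyck path above each of the k+1 basement boxes (basement box i
-- lies between column i-1 and column i), and the position (column
-- index) of the special box (nothing for the empty tableau).

record Tableau : Set where
  constructor tableau
  field
    columns  : List Column
    basement : List ℕ
    special  : Maybe ℕ
open Tableau public

emptyTableau : Tableau
emptyTableau = tableau [] (0 ∷ []) nothing

-- i-th element of a list of naturals (0 if out of range)
nth : ℕ → List ℕ → ℕ
nth _       []       = 0
nth zero    (x ∷ xs) = x
nth (suc i) (x ∷ xs) = nth i xs

mapBetween : {A : Set} → (A → A) → ℕ → ℕ → ℕ → List A → List A
mapBetween f lo hi from []       = []
mapBetween f lo hi from (a ∷ as) =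
  (if does ((lo <? from) ×-dec (from ≤? hi)) then f a else a)
    ∷ mapBetween f lo hi (suc from) as

raiseColumn : Column → Column
raiseColumn (column l h d) = column l (suc h) (suc d)

-- ribbon between the new column (index p) and the special column (index s+1
-- after insertion): raises by one box every column strictly between them
-- (indices p+1 .. s) and the Dyck path above every basement box strictly
-- between them (indices p+1 .. s+1).
addRibbon : ℕ → ℕ → Tableau → Tableau
addRibbon p s (tableau cs bs sp) =
  tableau (mapBetween raiseColumn p s 0 cs) (mapBetween suc p (suc s) 0 bs) sp

-- Insertion of a dotted box at basement box p (0 ≤ p ≤ size): a new
-- column (label = size) with its dot on the lower border, filling up to
-- the Dyck path above basement box p (which is split in two), then a
-- ribbon if the new column is to the left of the special box.
insertAt : Tableau → ℕ → Tableau
insertAt (tableau cs bs sp) p = withRibbon sp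
  where
    k  = length cs
    bp = nth p bs
    t′ : Tableau
    t′ = tableau (take p cs ++ column k (suc bp) 0 ∷ drop p cs)
                 (take p bs ++ bp ∷ drop p bs)
                 (just p)
    withRibbon : Maybe ℕ → Tableau
    withRibbon nothing  = t′
    withRibbon (just s) = if does (p ≤? s) then addRibbon p s t′ else t′

-- The Dyck tableau obtained by the successive insertions at the basement
-- labels c₀, c₁, … (step j, 0-based, chooses a label in 0 .. j).
build : List ℕ → Tableau
build = foldl insertAt emptyTableau

ValidFrom : ℕ → List ℕ → Set
ValidFrom j []       = ⊤
ValidFrom j (c ∷ cs) = (c ≤ j) × ValidFrom (suc j) cs

IsInsertionSequence : List ℕ → Set
IsInsertionSequence = ValidFrom 0

ShadowBox : Tableau → Set
ShadowBox T = Σ[ x ∈ Fin (length (columns T)) ] Σ[ r ∈ ℕ ]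
                (r < dotRow (lookup (columns T) x))

ClearBox : Tableau → Set
ClearBox T = Σ[ x ∈ Fin (length (columns T)) ] Σ[ r ∈ ℕ ]
               (dotRow (lookup (columns T) x) < r × r < height (lookup (columns T) x))

-- Permutations (values 0 .. n-1, i.e. shifted by one from the paper).

val : ∀ {n} → Permutation′ n → Fin n → ℕ
val σ j = toℕ (σ ⟨$⟩ʳ j)

-- Non-inversion table, indexed by values: for the value i = σ(j),
-- NI[i] = #{ j′ < j : σ(j′) < σ(j) }.
niAt : ∀ {n} → Permutation′ n → Fin n → ℕ
niAt {n} σ i =
  length (filter (λ j′ → (j′ F.<? (σ ⟨$⟩ˡ i)) ×-dec (σ ⟨$⟩ʳ j′ F.<? i)) (allFin n))

nonInversionTable : ∀ {n} → Permutation′ n → List ℕ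
nonInversionTable {n} σ = map (niAt σ) (allFin n)

Pattern2⁺12 : ∀ {n} → Permutation′ n → Set
Pattern2⁺12 {n} σ = Σ[ i ∈ Fin n ] Σ[ j ∈ Fin n ] Σ[ k ∈ Fin n ]
  (i F.< j × j F.< k × val σ i ≡ suc (val σ k) × val σ j < val σ k)

Pattern1⁺21 : ∀ {n} → Permutation′ n → Set
Pattern1⁺21 {n} σ = Σ[ i ∈ Fin n ] Σ[ j ∈ Fin n ] Σ[ k ∈ Fin n ]
  (i F.< j × j F.< k × val σ i ≡ suc (val σ k) × val σ i < val σ j)

-- Both bijections come from counting. Write pos v for the position of the value v in σ. Once the values
-- 0, …, k-1 are inserted, the column of u is the (rank k u)-th one, rank k u = #{v < k ∣ pos v < pos u},
-- and the Dyck path above a basement box is as high as the number of consecutive values c+1, c whose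
-- columns lie on either side of that box (their ribbon passes over it). Inserting k adds a ribbon from
-- k to k-1 exactly when pos k < pos (k-1); it lifts the dots of the columns strictly between them, one
-- shadow box per 2⁺12 pattern with top letter k. The clear boxes of the new column are the ribbons over
-- its basement box, one per 1⁺21 pattern with middle letter k, and later ribbons never change them.
-- Hence shadow and clear boxes are as numerous as the respective patterns, and two finite types of
-- the same cardinality are in bijection.
module Submission where

open import Defs
open import Data.Nat using (ℕ; zero; suc; pred; _+_; _∸_; _≤_; _<_; z≤n; s≤s; z<s; s≤s⁻¹; _≤?_; _<?_; _≟_)
open import Data.Nat.Properties
open import Data.Fin using (Fin; toℕ; fromℕ<)
import Data.Fin as F
import Data.Fin.Properties as FinP
open import Data.Fin.Permutation using (Permutation′; _⟨$⟩ʳ_; _⟨$⟩ˡ_; inverseˡ; inverseʳ; ↔⇒≡)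
open import Data.List using (List; []; _∷_; _++_; take; drop; length; lookup; map; filter; tabulate; foldl)
open import Data.List.Properties using (length-map; map-tabulate)
open import Data.Nat.ListAction using (sum)
open import Data.Maybe using (Maybe; just; nothing)
open import Data.Product using (Σ; Σ-syntax; _×_; _,_; proj₂)
open import Data.Sum using (_⊎_; inj₁; inj₂)
open import Data.Sum.Function.Propositional using (_⊎-cong_)
open import Data.Bool using (true; false; if_then_else_)
open import Data.Empty using (⊥-elim)
open import Function using (_∘_)
open import Function.Bundles using (_⇔_; _↔_; _⤖_; mk⇔; mk↔ₛ′; Equivalence)
open import Function.Properties.Inverse using (↔-sym; ↔-trans; ↔⇒⤖)
open import Relation.Nullary using (Dec; yes; no; does; ¬_; Irrelevant)
open import Relation.Nullary.Decidable using (_×-dec_; ¬?)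
open import Relation.Unary using (Decidable)
open import Relation.Binary.Definitions using (tri<; tri≈; tri>)
open import Relation.Binary.PropositionalEquality
open import Algebra.Properties.CommutativeSemigroup +-commutativeSemigroup using (interchange; x∙yz≈y∙xz)

private
  variable
    P Q : Set

-- Indicators and finite sums

⟦_⟧ : Dec P → ℕ
⟦ yes _ ⟧ = 1
⟦ no _ ⟧  = 0

⟦⟧-yes : (P? : Dec P) → P → ⟦ P? ⟧ ≡ 1
⟦⟧-yes (yes _) _ = refl
⟦⟧-yes (no ¬p) p = ⊥-elim (¬p p)

⟦⟧-no : (P? : Dec P) → ¬ P → ⟦ P? ⟧ ≡ 0
⟦⟧-no (yes p) ¬p = ⊥-elim (¬p p)
⟦⟧-no (no _)  _  = refl

⟦⟧≤1 : (P? : Dec P) → ⟦ P? ⟧ ≤ 1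
⟦⟧≤1 (yes _) = ≤-refl
⟦⟧≤1 (no _)  = z≤n

⟦⟧-mono : (P? : Dec P) (Q? : Dec Q) → (P → Q) → ⟦ P? ⟧ ≤ ⟦ Q? ⟧
⟦⟧-mono (yes p) Q? P⇒Q = ≤-reflexive (sym (⟦⟧-yes Q? (P⇒Q p)))
⟦⟧-mono (no _)  Q? P⇒Q = z≤n

⟦⟧-cong : (P? : Dec P) (Q? : Dec Q) → (P → Q) → (Q → P) → ⟦ P? ⟧ ≡ ⟦ Q? ⟧
⟦⟧-cong P? Q? P⇒Q Q⇒P = ≤-antisym (⟦⟧-mono P? Q? P⇒Q) (⟦⟧-mono Q? P? Q⇒P)

↔Fin⟦⟧ : (P? : Dec P) → Irrelevant P → P ↔ Fin ⟦ P? ⟧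
↔Fin⟦⟧ (yes p) irr = mk↔ₛ′ (λ _ → F.zero) (λ _ → p) (λ { F.zero → refl ; (F.suc ()) }) (irr p)
↔Fin⟦⟧ (no ¬p) irr = mk↔ₛ′ (⊥-elim ∘ ¬p) (λ ()) (λ ()) (⊥-elim ∘ ¬p)

∑ : ℕ → (ℕ → ℕ) → ℕ
∑ zero    f = 0
∑ (suc k) f = ∑ k f + f k

syntax ∑ k (λ v → e) = ∑[ v < k ] e

module _ {f g : ℕ → ℕ} where

  ∑-cong : ∀ k → (∀ {v} → v < k → f v ≡ g v) → ∑ k f ≡ ∑ k g
  ∑-cong zero    _  = refl
  ∑-cong (suc k) eq = cong₂ _+_ (∑-cong k (eq ∘ m<n⇒m<1+n)) (eq (n<1+n k))

  ∑-mono : ∀ k → (∀ {v} → v < k → f v ≤ g v) → ∑ k f ≤ ∑ k g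
  ∑-mono zero    _  = z≤n
  ∑-mono (suc k) le = +-mono-≤ (∑-mono k (le ∘ m<n⇒m<1+n)) (le (n<1+n k))

  ∑-mono-< : ∀ k → (∀ {v} → v < k → f v ≤ g v) → ∀ {u} → u < k → f u < g u →
             ∑ k f < ∑ k g
  ∑-mono-< (suc k) le u<1+k fu<gu with m<1+n⇒m<n∨m≡n u<1+k
  ... | inj₁ u<k  = +-mono-<-≤ (∑-mono-< k (le ∘ m<n⇒m<1+n) u<k fu<gu) (le (n<1+n k))
  ... | inj₂ refl = +-mono-≤-< (∑-mono k (le ∘ m<n⇒m<1+n)) fu<gu

  ∑-+ : ∀ k → ∑[ v < k ] (f v + g v) ≡ ∑ k f + ∑ k g
  ∑-+ zero    = refl
  ∑-+ (suc k) = trans (cong (_+ (f k + g k)) (∑-+ k)) (interchange (∑ k f) (∑ k g) (f k) (g k))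

∑-zero : ∀ k {f : ℕ → ℕ} → (∀ {v} → v < k → f v ≡ 0) → ∑ k f ≡ 0
∑-zero zero    _   = refl
∑-zero (suc k) eq = cong₂ _+_ (∑-zero k (eq ∘ m<n⇒m<1+n)) (eq (n<1+n k))

∑-⟦⟧≤ : ∀ k {P : ℕ → Set} (P? : Decidable P) → ∑[ v < k ] ⟦ P? v ⟧ ≤ k
∑-⟦⟧≤ zero    P? = z≤n
∑-⟦⟧≤ (suc k) P? = ≤-trans (+-mono-≤ (∑-⟦⟧≤ k P?) (⟦⟧≤1 (P? k))) (≤-reflexive (+-comm k 1))

-- Counting by bijections with Fin

Σ-≡-irrelevant : ∀ {A : Set} {B : A → Set} → (∀ {a} → Irrelevant (B a)) →
                 ∀ {a a′ b b′} → a ≡ a′ → (a , b) ≡ (a′ , b′)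
Σ-≡-irrelevant {B = B} irr {a} refl = cong (_,_ {B = B} a) (irr _ _)

×-irrelevant : ∀ {A B : Set} → Irrelevant A → Irrelevant B → Irrelevant (A × B)
×-irrelevant irrA irrB (a , b) (a′ , b′) = cong₂ _,_ (irrA a a′) (irrB b b′)

Σ³-≡ : ∀ {n} {P : Fin n → Fin n → Fin n → Set} → (∀ {i j k} → Irrelevant (P i j k)) →
       ∀ {i i′ j j′ k k′ p p′} → i ≡ i′ → j ≡ j′ → k ≡ k′ →
       _≡_ {A = Σ[ i ∈ Fin n ] Σ[ j ∈ Fin n ] Σ[ k ∈ Fin n ] P i j k}
           (i , j , k , p) (i′ , j′ , k′ , p′)
Σ³-≡ irr {p = p} {p′} refl refl refl rewrite irr p p′ = refl

Σ²-≡ : ∀ {m} {h : ℕ → ℕ} {R : ℕ → ℕ → Set} → (∀ {x y} → Irrelevant (R x y)) →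
       ∀ {x x′ y y′ p p′ q q′ r r′} → x ≡ x′ → y ≡ y′ →
       _≡_ {A = Σ[ x ∈ ℕ ] (x < m × Σ[ y ∈ ℕ ] (y < h x × R x y))}
           (x , p , y , q , r) (x′ , p′ , y′ , q′ , r′)
Σ²-≡ irr {p = p} {p′} {q = q} {q′} {r = r} {r′} refl refl
  rewrite <-irrelevant p p′ | <-irrelevant q q′ | irr r r′ = refl

Σ<-suc↔ : ∀ {k} {B : ℕ → Set} →
          (Σ[ v ∈ ℕ ] (v < suc k × B v)) ↔ ((Σ[ v ∈ ℕ ] (v < k × B v)) ⊎ B k)
Σ<-suc↔ {k} {B} = mk↔ₛ′ to from to∘from from∘to
  where
  split : ∀ {v} → B v → v < k ⊎ v ≡ k → (Σ[ v ∈ ℕ ] (v < k × B v)) ⊎ B k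
  split b (inj₁ v<k)  = inj₁ (_ , v<k , b)
  split b (inj₂ refl) = inj₂ b
  to : Σ[ v ∈ ℕ ] (v < suc k × B v) → (Σ[ v ∈ ℕ ] (v < k × B v)) ⊎ B k
  to (v , v<1+k , b) = split b (m<1+n⇒m<n∨m≡n v<1+k)
  from : (Σ[ v ∈ ℕ ] (v < k × B v)) ⊎ B k → Σ[ v ∈ ℕ ] (v < suc k × B v)
  from (inj₁ (v , v<k , b)) = v , m<n⇒m<1+n v<k , b
  from (inj₂ b)             = k , n<1+n k , b
  to∘from : ∀ y → to (from y) ≡ y
  to∘from (inj₁ (v , v<k , b)) with m<1+n⇒m<n∨m≡n (m<n⇒m<1+n v<k)
  ... | inj₁ v<k′ = cong (λ p → inj₁ (v , p , b)) (<-irrelevant v<k′ v<k)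
  ... | inj₂ refl = ⊥-elim (<-irrefl refl v<k)
  to∘from (inj₂ b) with m<1+n⇒m<n∨m≡n (n<1+n k)
  ... | inj₁ k<k  = ⊥-elim (<-irrefl refl k<k)
  ... | inj₂ refl = refl
  from∘to : ∀ x → from (to x) ≡ x
  from∘to (v , v<1+k , b) with m<1+n⇒m<n∨m≡n v<1+k
  ... | inj₁ _    = cong (λ p → v , p , b) (<-irrelevant _ _)
  ... | inj₂ refl = cong (λ p → v , p , b) (<-irrelevant _ _)

Σ<↔Fin∑ : ∀ k {B : ℕ → Set} {f : ℕ → ℕ} → (∀ v → B v ↔ Fin (f v)) →
           (Σ[ v ∈ ℕ ] (v < k × B v)) ↔ Fin (∑ k f)
Σ<↔Fin∑ zero    B↔ = mk↔ₛ′ (λ { (_ , () , _) }) (λ ()) (λ ()) (λ { (_ , () , _) })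
Σ<↔Fin∑ (suc k) B↔ =
  ↔-trans Σ<-suc↔ (↔-trans (Σ<↔Fin∑ k B↔ ⊎-cong B↔ k) (↔-sym (FinP.+↔⊎ {∑ k _})))

Σ-Fin-suc↔ : ∀ {n} {B : Fin (suc n) → Set} → Σ (Fin (suc n)) B ↔ (B F.zero ⊎ Σ (Fin n) (B ∘ F.suc))
Σ-Fin-suc↔ = mk↔ₛ′ (λ { (F.zero , b) → inj₁ b ; (F.suc i , b) → inj₂ (i , b) })
                    (λ { (inj₁ b) → F.zero , b ; (inj₂ (i , b)) → F.suc i , b })
                    (λ { (inj₁ _) → refl ; (inj₂ _) → refl })
                    (λ { (F.zero , _) → refl ; (F.suc _ , _) → refl })

Σ-lookup↔Fin-sum : ∀ {A : Set} {B : A → Set} {f : A → ℕ} → (∀ x → B x ↔ Fin (f x)) →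
                    (xs : List A) → (Σ[ i ∈ Fin (length xs) ] B (lookup xs i)) ↔ Fin (sum (map f xs))
Σ-lookup↔Fin-sum B↔ []       = mk↔ₛ′ (λ { (() , _) }) (λ ()) (λ ()) (λ { (() , _) })
Σ-lookup↔Fin-sum B↔ (x ∷ xs) =
  ↔-trans Σ-Fin-suc↔ (↔-trans (B↔ x ⊎-cong Σ-lookup↔Fin-sum B↔ xs) (↔-sym FinP.+↔⊎))

length-filter-∷ : ∀ {A : Set} {P : A → Set} (P? : Decidable P) x xs →
                  length (filter P? (x ∷ xs)) ≡ ⟦ P? x ⟧ + length (filter P? xs)
length-filter-∷ P? x xs with P? x
... | yes _ = refl
... | no _  = refl

Σ↔Fin-filter : ∀ {A : Set} {P : A → Set} (P? : Decidable P) → (∀ {x} → Irrelevant (P x)) →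
                ∀ {m} (g : Fin m → A) → Σ (Fin m) (P ∘ g) ↔ Fin (length (filter P? (tabulate g)))
Σ↔Fin-filter P? irr {zero}  g = mk↔ₛ′ (λ { (() , _) }) (λ ()) (λ ()) (λ { (() , _) })
Σ↔Fin-filter {P = P} P? irr {suc m} g =
  subst (λ l → Σ (Fin (suc m)) (P ∘ g) ↔ Fin l) (sym (length-filter-∷ P? (g F.zero) _))
    (↔-trans Σ-Fin-suc↔ (↔-trans (↔Fin⟦⟧ (P? (g F.zero)) irr ⊎-cong Σ↔Fin-filter P? irr (g ∘ F.suc))
                                 (↔-sym FinP.+↔⊎)))

Σ<↔Fin : ∀ d → (Σ[ r ∈ ℕ ] r < d) ↔ Fin d
Σ<↔Fin d = mk↔ₛ′ (λ (_ , r<d) → fromℕ< r<d) (λ i → toℕ i , FinP.toℕ<n i)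
  (λ i → FinP.fromℕ<-toℕ i (FinP.toℕ<n i))
  (λ (_ , r<d) → Σ-≡-irrelevant <-irrelevant (FinP.toℕ-fromℕ< r<d))

Σ-between↔Fin : ∀ d h → (Σ[ r ∈ ℕ ] (d < r × r < h)) ↔ Fin (h ∸ suc d)
Σ-between↔Fin d h = ↔-trans (mk↔ₛ′ to from to∘from from∘to) (Σ<↔Fin (h ∸ suc d))
  where
  to : Σ[ r ∈ ℕ ] (d < r × r < h) → Σ[ t ∈ ℕ ] t < h ∸ suc d
  to (r , d<r , r<h) = r ∸ suc d , ∸-monoˡ-< r<h d<r
  from : Σ[ t ∈ ℕ ] t < h ∸ suc d → Σ[ r ∈ ℕ ] (d < r × r < h)
  from (t , t<) = t + suc d , m≤n+m (suc d) t , m≤o∸n⇒m+n≤o (suc t) d<h t<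
    where
    d<h : suc d ≤ h
    d<h = <⇒≤ (m∸n≢0⇒n<m λ eq → n≮0 (subst (t <_) eq t<))
  to∘from : ∀ y → to (from y) ≡ y
  to∘from (t , _) = Σ-≡-irrelevant <-irrelevant (m+n∸n≡m t (suc d))
  from∘to : ∀ x → from (to x) ≡ x
  from∘to (r , d<r , _) = Σ-≡-irrelevant (×-irrelevant <-irrelevant <-irrelevant) (m∸n+n≡m d<r)

-- Lists and columns: insertion at an index and raising a range

insert : ∀ {A : Set} → ℕ → A → List A → List A
insert p x xs = take p xs ++ x ∷ drop p xs

module _ {A : Set} where

  length-insert : ∀ p (x : A) xs → length (insert p x xs) ≡ suc (length xs)
  length-insert zero    x xs       = refl
  length-insert (suc p) x []       = refl
  length-insert (suc p) x (y ∷ ys) = cong suc (length-insert p x ys)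

  sum-map-insert : ∀ (f : A → ℕ) p x xs → sum (map f (insert p x xs)) ≡ f x + sum (map f xs)
  sum-map-insert f zero    x xs       = refl
  sum-map-insert f (suc p) x []       = refl
  sum-map-insert f (suc p) x (y ∷ ys) =
    trans (cong (f y +_) (sum-map-insert f p x ys)) (x∙yz≈y∙xz (f y) (f x) _)

nth-insert-< : ∀ {g p} x xs → g < p → p ≤ length xs → nth g (insert p x xs) ≡ nth g xs
nth-insert-< {zero}  {suc p} x (y ∷ ys) g<p       p≤ = refl
nth-insert-< {suc g} {suc p} x (y ∷ ys) (s≤s g<p) (s≤s p≤) = nth-insert-< x ys g<p p≤

nth-insert-≡ : ∀ p x xs → p ≤ length xs → nth p (insert p x xs) ≡ x
nth-insert-≡ zero    x xs       _       = refl
nth-insert-≡ (suc p) x (y ∷ ys) (s≤s p≤) = nth-insert-≡ p x ys p≤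

nth-insert-> : ∀ {g p} x xs → p ≤ g → nth (suc g) (insert p x xs) ≡ nth g xs
nth-insert-> {g}     {zero}  x xs       _         = refl
nth-insert-> {suc g} {suc p} x []       _         = refl
nth-insert-> {suc g} {suc p} x (y ∷ ys) (s≤s p≤g) = nth-insert-> x ys p≤g

inRange? : ∀ lo hi x → Dec (lo < x × x ≤ hi)
inRange? lo hi x = (lo <? x) ×-dec (x ≤? hi)

module _ {A : Set} (f : A → A) (lo hi : ℕ) where

  length-mapBetween : ∀ from xs → length (mapBetween f lo hi from xs) ≡ length xs
  length-mapBetween from []       = refl
  length-mapBetween from (x ∷ xs) = cong suc (length-mapBetween (suc from) xs)

  map-mapBetween : ∀ {B : Set} (h : A → B) (f′ : B → B) → (∀ x → h (f x) ≡ f′ (h x)) →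
                   ∀ from xs → map h (mapBetween f lo hi from xs) ≡ mapBetween f′ lo hi from (map h xs)
  map-mapBetween h f′ comm from []       = refl
  map-mapBetween h f′ comm from (x ∷ xs) = cong₂ _∷_ head (map-mapBetween h f′ comm (suc from) xs)
    where
    head : h (if does (inRange? lo hi from) then f x else x)
         ≡ (if does (inRange? lo hi from) then f′ (h x) else h x)
    head with does (inRange? lo hi from)
    ... | true  = comm x
    ... | false = refl

  map-mapBetween-invariant : ∀ {B : Set} (h : A → B) → (∀ x → h (f x) ≡ h x) →
                             ∀ from xs → map h (mapBetween f lo hi from xs) ≡ map h xs
  map-mapBetween-invariant h inv from []       = refl
  map-mapBetween-invariant h inv from (x ∷ xs) = cong₂ _∷_ head (map-mapBetween-invariant h inv (suc from) xs)
    where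
    head : h (if does (inRange? lo hi from) then f x else x) ≡ h x
    head with does (inRange? lo hi from)
    ... | true  = inv x
    ... | false = refl

if-does : ∀ {P A : Set} (B : A → Set) {x y} (P? : Dec P) → (P → B x) → (¬ P → B y) →
          B (if does P? then x else y)
if-does B (yes p) then-case _ = then-case p
if-does B (no ¬p) _ else-case = else-case ¬p

if-suc : ∀ {P : Set} (P? : Dec P) a → (if does P? then suc a else a) ≡ a + ⟦ P? ⟧
if-suc (yes _) a = +-comm 1 a
if-suc (no _)  a = sym (+-identityʳ a)

module _ (lo hi : ℕ) where

  nth-mapBetween-suc : ∀ from g xs → g < length xs →
                       nth g (mapBetween suc lo hi from xs) ≡ nth g xs + ⟦ inRange? lo hi (from + g) ⟧
  nth-mapBetween-suc from zero (x ∷ xs) _ =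
    trans (if-suc (inRange? lo hi from) x) (cong (λ y → x + ⟦ inRange? lo hi y ⟧) (sym (+-identityʳ from)))
  nth-mapBetween-suc from (suc g) (x ∷ xs) (s≤s g<) =
    trans (nth-mapBetween-suc (suc from) g xs g<)
          (cong (λ y → nth g xs + ⟦ inRange? lo hi y ⟧) (sym (+-suc from g)))

  private
    ⟦≤⟧+∸ : ∀ m n → ⟦ m ≤? n ⟧ + (n ∸ m) ≡ suc n ∸ m
    ⟦≤⟧+∸ m n with m ≤? n
    ... | yes m≤n = sym (+-∸-assoc 1 m≤n)
    ... | no  m≰n = trans (m≤n⇒m∸n≡0 (<⇒≤ (≰⇒> m≰n))) (sym (m≤n⇒m∸n≡0 (≰⇒> m≰n)))

  sum-mapBetween-suc-above : ∀ from xs → lo < from → hi < from + length xs →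
                             sum (mapBetween suc lo hi from xs) ≡ sum xs + (suc hi ∸ from)
  sum-mapBetween-suc-above from [] _ hi< =
    sym (m≤n⇒m∸n≡0 (subst (hi <_) (+-identityʳ from) hi<))
  sum-mapBetween-suc-above from (x ∷ xs) lo<from hi< = begin
    (if does here? then suc x else x) + sum (mapBetween suc lo hi (suc from) xs)
      ≡⟨ cong₂ _+_ (if-suc here? x) (sum-mapBetween-suc-above (suc from) xs (m<n⇒m<1+n lo<from) hi<′) ⟩
    (x + ⟦ here? ⟧) + (sum xs + (hi ∸ from))
      ≡⟨ interchange x _ (sum xs) _ ⟩
    (x + sum xs) + (⟦ here? ⟧ + (hi ∸ from))
      ≡⟨ cong (λ c → (x + sum xs) + (c + (hi ∸ from))) (⟦⟧-cong here? (from ≤? hi) proj₂ (lo<from ,_)) ⟩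
    (x + sum xs) + (⟦ from ≤? hi ⟧ + (hi ∸ from))
      ≡⟨ cong ((x + sum xs) +_) (⟦≤⟧+∸ from hi) ⟩
    (x + sum xs) + (suc hi ∸ from) ∎
    where
    open ≡-Reasoning
    here? = inRange? lo hi from
    hi<′ = subst (hi <_) (+-suc from _) hi<

  sum-mapBetween-suc : ∀ from xs → from ≤ suc lo → hi < from + length xs →
                       sum (mapBetween suc lo hi from xs) ≡ sum xs + (hi ∸ lo)
  sum-mapBetween-suc from [] from≤ hi< =
    sym (m≤n⇒m∸n≡0 (s≤s⁻¹ (≤-trans (subst (hi <_) (+-identityʳ from) hi<) from≤)))
  sum-mapBetween-suc from (x ∷ xs) from≤ hi< with from ≟ suc lo
  ... | yes refl = sum-mapBetween-suc-above from (x ∷ xs) ≤-refl hi<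
  ... | no  from≢ = begin
    (if does here? then suc x else x) + sum (mapBetween suc lo hi (suc from) xs)
      ≡⟨ cong₂ _+_ (trans (if-suc here? x) (cong (x +_) not-here))
                   (sum-mapBetween-suc (suc from) xs (≤∧≢⇒< from≤ from≢) (subst (hi <_) (+-suc from _) hi<)) ⟩
    (x + 0) + (sum xs + (hi ∸ lo))
      ≡⟨ cong (_+ _) (+-identityʳ x) ⟩
    x + (sum xs + (hi ∸ lo))
      ≡⟨ sym (+-assoc x _ _) ⟩
    (x + sum xs) + (hi ∸ lo) ∎
    where
    open ≡-Reasoning
    here? = inRange? lo hi from
    not-here : ⟦ here? ⟧ ≡ 0
    not-here = ⟦⟧-no here? λ (lo<from , _) → from≢ (≤-antisym from≤ lo<from)

clearBoxes : Column → ℕ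
clearBoxes c = height c ∸ suc (dotRow c)

dotRow-raise : ∀ c → dotRow (raiseColumn c) ≡ suc (dotRow c)
dotRow-raise (column _ _ _) = refl

clearBoxes-raise : ∀ c → clearBoxes (raiseColumn c) ≡ clearBoxes c
clearBoxes-raise (column _ _ _) = refl

-- Ranks and the insertion process

+1≡suc : ∀ x → x + 1 ≡ suc x
+1≡suc x = +-comm x 1

-- Inserting a column at index p moves an older column from index x to x + ⟦ p ≤ x ⟧.
shift-<-below : ∀ {p g} x → g ≤ p → (x + ⟦ p ≤? x ⟧ < g) ⇔ (x < g)
shift-<-below {p} {g} x g≤p with p ≤? x
... | yes p≤x = mk⇔ (λ lt → impossible (<-trans (n<1+n x) (subst (_< g) (+1≡suc x) lt))) impossible
  where
  impossible : ∀ {A : Set} → x < g → A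
  impossible x<g = ⊥-elim (<⇒≱ (<-≤-trans x<g g≤p) p≤x)
... | no  _   = mk⇔ (subst (_< g) (+-identityʳ x)) (subst (_< g) (sym (+-identityʳ x)))

shift-<-above : ∀ {p h} x → p ≤ h → (x + ⟦ p ≤? x ⟧ < suc h) ⇔ (x < h)
shift-<-above {p} {h} x p≤h with p ≤? x
... | yes _   = mk⇔ (s≤s⁻¹ ∘ subst (_< suc h) (+1≡suc x)) (subst (_< suc h) (sym (+1≡suc x)) ∘ s≤s)
... | no  p≰x = mk⇔ (λ _ → x<h) (λ _ → subst (_< suc h) (sym (+-identityʳ x)) (m<n⇒m<1+n x<h))
  where
  x<h : x < h
  x<h = <-≤-trans (≰⇒> p≰x) p≤h

<pred⇒suc< : ∀ {c k} → c < pred k → suc c < k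
<pred⇒suc< {k = suc k} c<k = s≤s c<k

module Insertion (pos : ℕ → ℕ) (pos-injective : ∀ {u w} → pos u ≡ pos w → u ≡ w) where

  open Equivalence using (to; from)

  rank : ℕ → ℕ → ℕ
  rank k u = ∑[ v < k ] ⟦ pos v <? pos u ⟧

  rank≤ : ∀ k u → rank k u ≤ k
  rank≤ k u = ∑-⟦⟧≤ k (λ v → pos v <? pos u)

  rank-mono : ∀ k {u w} → pos u ≤ pos w → rank k u ≤ rank k w
  rank-mono k pu≤pw = ∑-mono k λ _ → ⟦⟧-mono (_ <? _) (_ <? _) (λ lt → <-≤-trans lt pu≤pw)

  pos<⇒rank< : ∀ {k u w} → u < k → pos u < pos w → rank k u < rank k w
  pos<⇒rank< {k} {u} u<k pu<pw = ∑-mono-< k (λ _ → ⟦⟧-mono (_ <? _) (_ <? _) (λ lt → <-trans lt pu<pw)) u<k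
    (subst₂ _<_ (sym (⟦⟧-no (pos u <? pos u) (<-irrefl refl))) (sym (⟦⟧-yes (pos u <? _) pu<pw)) z<s)

  rank<⇒pos< : ∀ {k u w} → rank k u < rank k w → pos u < pos w
  rank<⇒pos< {k} r< = ≰⇒> λ pw≤pu → <⇒≱ r< (rank-mono k pw≤pu)

  pos<⇔rank≤ : ∀ {k u} → u < k → (pos k < pos u) ⇔ (rank k k ≤ rank k u)
  pos<⇔rank≤ {k} {u} u<k = mk⇔ (rank-mono k ∘ <⇒≤) λ r≤ → ≤∧≢⇒<
    (≮⇒≥ λ pu<pk → <⇒≱ (pos<⇒rank< u<k pu<pk) r≤)
    (λ pk≡pu → <-irrefl (sym (pos-injective pk≡pu)) u<k)

  rank-suc : ∀ {k u} → u < k → rank (suc k) u ≡ rank k u + ⟦ rank k k ≤? rank k u ⟧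
  rank-suc {k} {u} u<k = cong (rank k u +_)
    (⟦⟧-cong (pos k <? pos u) (_ ≤? _) (to (pos<⇔rank≤ u<k)) (from (pos<⇔rank≤ u<k)))

  rank-suc-self : ∀ k → rank (suc k) k ≡ rank k k
  rank-suc-self k = trans (cong (rank k k +_) (⟦⟧-no (pos k <? pos k) (<-irrefl refl))) (+-identityʳ _)

  inside? : ∀ u w v → Dec (pos u < pos v × pos v < pos w)
  inside? u w v = (pos u <? pos v) ×-dec (pos v <? pos w)

  between : ℕ → ℕ → ℕ → ℕ
  between k u w = ∑[ v < k ] ⟦ inside? u w v ⟧

  rank-between : ∀ {k u w} → k ≤ u → pos u < pos w → rank k w ≡ rank k u + between k u w
  rank-between {k} {u} {w} k≤u pu<pw = trans (∑-cong k split) (∑-+ k)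
    where
    split : ∀ {v} → v < k → ⟦ pos v <? pos w ⟧ ≡ ⟦ pos v <? pos u ⟧ + ⟦ inside? u w v ⟧
    split {v} v<k with <-cmp (pos v) (pos u)
    ... | tri< pv<pu _ _ = trans (⟦⟧-yes (_ <? _) (<-trans pv<pu pu<pw))
      (sym (cong₂ _+_ (⟦⟧-yes (_ <? _) pv<pu) (⟦⟧-no (inside? u w v) (λ (pu<pv , _) → <-asym pv<pu pu<pv))))
    ... | tri≈ _ pv≡pu _ = ⊥-elim (<-irrefl (pos-injective pv≡pu) (<-≤-trans v<k k≤u))
    ... | tri> _ _ pu<pv = trans (⟦⟧-cong (_ <? _) (inside? u w v) (pu<pv ,_) proj₂)
      (sym (cong (_+ ⟦ inside? u w v ⟧) (⟦⟧-no (_ <? _) (<-asym pu<pv))))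

  -- The ribbon from c+1 to c passes over basement box g.
  crosses? : ∀ k g c → Dec (rank k (suc c) < g × ¬ rank k c < g)
  crosses? k g c = (rank k (suc c) <? g) ×-dec ¬? (rank k c <? g)

  crossing : ℕ → ℕ → ℕ → ℕ
  crossing k g c = ⟦ crosses? k g c ⟧

  crossings : ℕ → ℕ → ℕ
  crossings k g = ∑[ c < pred k ] crossing k g c

  newCrossing : ℕ → ℕ → ℕ
  newCrossing zero    g = 0
  newCrossing (suc m) g = crossing (suc (suc m)) g m

  crossings-suc : ∀ k g → crossings (suc k) g ≡ ∑[ c < pred k ] crossing (suc k) g c + newCrossing k g
  crossings-suc zero    g = refl
  crossings-suc (suc m) g = refl

  count2⁺12-top : ℕ → ℕ
  count2⁺12-top zero    = 0
  count2⁺12-top (suc c) = between c (suc c) c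

  count2⁺12 : ℕ → ℕ
  count2⁺12 k = ∑[ c < pred k ] between c (suc c) c

  count2⁺12-suc : ∀ k → count2⁺12 (suc k) ≡ count2⁺12 k + count2⁺12-top k
  count2⁺12-suc zero    = refl
  count2⁺12-suc (suc m) = refl

  around? : ∀ b c → Dec (pos (suc c) < pos b × pos b < pos c)
  around? b c = (pos (suc c) <? pos b) ×-dec (pos b <? pos c)

  count1⁺21-middle : ℕ → ℕ
  count1⁺21-middle b = ∑[ c < pred b ] ⟦ around? b c ⟧

  count1⁺21 : ℕ → ℕ
  count1⁺21 k = ∑[ b < k ] count1⁺21-middle b

  count1⁺21-middle≡crossings : ∀ k → count1⁺21-middle k ≡ crossings k (rank k k)
  count1⁺21-middle≡crossings k = ∑-cong (pred k) λ {c} c<k-1 →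
    let c+1<k = <pred⇒suc< c<k-1
        c<k   = <-trans (n<1+n c) c+1<k
    in ⟦⟧-cong (around? k c) (crosses? k (rank k k) c)
         (λ (l , r) → pos<⇒rank< {k} c+1<k l , ≤⇒≯ (to (pos<⇔rank≤ c<k) r))
         (λ (l , r) → rank<⇒pos< {k} l , from (pos<⇔rank≤ c<k) (≮⇒≥ r))

  crossing-cong : ∀ {k k′ g g′} c → (∀ {u} → u < k → (rank k′ u < g′) ⇔ (rank k u < g)) →
                  c < pred k → crossing k′ g′ c ≡ crossing k g c
  crossing-cong {k} {k′} {g} {g′} c sides c<k-1 = ⟦⟧-cong (crosses? k′ g′ c) (crosses? k g c)
    (λ (l , r) → to (sides c+1<k) l , r ∘ from (sides c<k))
    (λ (l , r) → from (sides c+1<k) l , r ∘ to (sides c<k))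
    where
    c+1<k = <pred⇒suc< c<k-1
    c<k   = <-trans (n<1+n c) c+1<k

  crossings-below : ∀ {k g} → g ≤ rank k k → crossings (suc k) g ≡ crossings k g + newCrossing k g
  crossings-below {k} {g} g≤p = trans (crossings-suc k g) (cong (_+ newCrossing k g)
    (∑-cong (pred k) (crossing-cong _ λ {u} u<k →
      subst (λ r → (r < g) ⇔ (rank k u < g)) (sym (rank-suc u<k)) (shift-<-below (rank k u) g≤p))))

  crossings-above : ∀ {k h} → rank k k ≤ h → crossings (suc k) (suc h) ≡ crossings k h + newCrossing k (suc h)
  crossings-above {k} {h} p≤h = trans (crossings-suc k (suc h)) (cong (_+ newCrossing k (suc h))
    (∑-cong (pred k) (crossing-cong _ λ {u} u<k →
      subst (λ r → (r < suc h) ⇔ (rank k u < h)) (sym (rank-suc u<k)) (shift-<-above (rank k u) p≤h))))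

  module _ (m : ℕ) where

    private
      p s : ℕ
      p = rank (suc m) (suc m)
      s = rank (suc m) m

      rank-new : rank (suc (suc m)) (suc m) ≡ p
      rank-new = rank-suc-self (suc m)

      rank-special : rank (suc (suc m)) m ≡ s + ⟦ p ≤? s ⟧
      rank-special = rank-suc (n<1+n m)

    newCrossing-ribbon : p ≤ s → ∀ g → newCrossing (suc m) g ≡ ⟦ inRange? p (suc s) g ⟧
    newCrossing-ribbon p≤s g = ⟦⟧-cong (crosses? _ g m) (inRange? p (suc s) g)
      (λ (l , r) → subst (_< g) rank-new l , ≮⇒≥ (r ∘ subst (_< g) (sym s′≡)))
      (λ (l , r) → subst (_< g) (sym rank-new) l , ≤⇒≯ r ∘ subst (_< g) s′≡)
      where
      s′≡ : rank (suc (suc m)) m ≡ suc s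
      s′≡ = trans rank-special (trans (cong (s +_) (⟦⟧-yes (p ≤? s) p≤s)) (+1≡suc s))

    newCrossing-none : ¬ p ≤ s → ∀ g → newCrossing (suc m) g ≡ 0
    newCrossing-none p≰s g = ⟦⟧-no (crosses? _ g m) λ (l , r) →
      r (subst (_< g) (sym s′≡) (<-trans (≰⇒> p≰s) (subst (_< g) rank-new l)))
      where
      s′≡ : rank (suc (suc m)) m ≡ s
      s′≡ = trans rank-special (trans (cong (s +_) (⟦⟧-no (p ≤? s) p≰s)) (+-identityʳ s))

    count2⁺12-top-ribbon : p ≤ s → p + count2⁺12-top (suc m) ≡ s
    count2⁺12-top-ribbon p≤s = sym (begin
      s
        ≡⟨ rank-between ≤-refl (from (pos<⇔rank≤ (n<1+n m)) p≤s) ⟩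
      p + (between m (suc m) m + ⟦ inside? (suc m) m m ⟧)
        ≡⟨ cong (λ x → p + (between m (suc m) m + x)) no-self ⟩
      p + (between m (suc m) m + 0)
        ≡⟨ cong (p +_) (+-identityʳ _) ⟩
      p + count2⁺12-top (suc m) ∎)
      where
      open ≡-Reasoning
      no-self : ⟦ inside? (suc m) m m ⟧ ≡ 0
      no-self = ⟦⟧-no (inside? (suc m) m m) (<-irrefl refl ∘ proj₂)

    count2⁺12-top-none : ¬ p ≤ s → count2⁺12-top (suc m) ≡ 0
    count2⁺12-top-none p≰s = ∑-zero m λ {b} _ → ⟦⟧-no (inside? (suc m) m b) λ (l , r) →
      <-asym (<-trans l r) (rank<⇒pos< {suc m} (≰⇒> p≰s))

  lastDot : ℕ → Maybe ℕ
  lastDot zero    = nothing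
  lastDot (suc m) = just (rank (suc m) m)

  record Invariant (k : ℕ) (T : Tableau) : Set where
    field
      columns-length  : length (columns T) ≡ k
      basement-length : length (basement T) ≡ suc k
      basement-height : ∀ g → g ≤ k → nth g (basement T) ≡ crossings k g
      special-last    : special T ≡ lastDot k
      shadow-total    : sum (map dotRow (columns T)) ≡ count2⁺12 k
      clear-total     : sum (map clearBoxes (columns T)) ≡ count1⁺21 k

  emptyTableau-invariant : Invariant 0 emptyTableau
  emptyTableau-invariant = record
    { columns-length  = refl
    ; basement-length = refl
    ; basement-height = λ { zero _ → refl }
    ; special-last    = refl
    ; shadow-total    = refl
    ; clear-total     = refl
    }

  -- The tableau once the dot of k is placed, before its ribbon is added.
  record DotPlaced (k : ℕ) (T : Tableau) : Set where
    field
      columns-length  : length (columns T) ≡ suc k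
      basement-length : length (basement T) ≡ suc (suc k)
      basement-height : ∀ g → g ≤ suc k → nth g (basement T) + newCrossing k g ≡ crossings (suc k) g
      special-last    : special T ≡ lastDot (suc k)
      shadow-total    : sum (map dotRow (columns T)) + count2⁺12-top k ≡ count2⁺12 (suc k)
      clear-total     : sum (map clearBoxes (columns T)) ≡ count1⁺21 (suc k)

  place-dot : ∀ {k cs bs sp} → Invariant k (tableau cs bs sp) →
              let p = rank k k in
              DotPlaced k (tableau (insert p (column (length cs) (suc (nth p bs)) 0) cs)
                                   (insert p (nth p bs) bs) (just p))
  place-dot {k} {cs} {bs} I = record
    { columns-length  = trans (length-insert p _ cs) (cong suc I.columns-length)
    ; basement-length = trans (length-insert p _ bs) (cong suc I.basement-length)
    ; basement-height = heights
    ; special-last    = cong just (sym (rank-suc-self k))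
    ; shadow-total    = trans (cong (_+ count2⁺12-top k) (trans (sum-map-insert dotRow p _ cs) I.shadow-total))
                              (sym (count2⁺12-suc k))
    ; clear-total     = begin
        sum (map clearBoxes (insert p _ cs))  ≡⟨ sum-map-insert clearBoxes p _ cs ⟩
        nth p bs + sum (map clearBoxes cs)    ≡⟨ cong₂ _+_ new-clears I.clear-total ⟩
        count1⁺21-middle k + count1⁺21 k      ≡⟨ +-comm (count1⁺21-middle k) _ ⟩
        count1⁺21 (suc k)                     ∎
    }
    where
    module I = Invariant I
    open ≡-Reasoning
    p = rank k k
    p≤k = rank≤ k k
    p≤length = subst (p ≤_) (sym I.basement-length) (m≤n⇒m≤1+n p≤k)
    new-clears : nth p bs ≡ count1⁺21-middle k
    new-clears = trans (I.basement-height p p≤k) (sym (count1⁺21-middle≡crossings k))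
    heights : ∀ g → g ≤ suc k → nth g (insert p (nth p bs) bs) + newCrossing k g ≡ crossings (suc k) g
    heights g _ with <-cmp g p
    ... | tri< g<p _ _ =
      trans (cong (_+ newCrossing k g) (trans (nth-insert-< _ bs g<p p≤length)
                                              (I.basement-height g (<⇒≤ (<-≤-trans g<p p≤k)))))
            (sym (crossings-below {k} (<⇒≤ g<p)))
    ... | tri≈ _ refl _ =
      trans (cong (_+ newCrossing k g) (trans (nth-insert-≡ p _ bs p≤length) (I.basement-height p p≤k)))
            (sym (crossings-below {k} ≤-refl))
    heights (suc h) h<k+1 | tri> _ _ p<h+1 =
      trans (cong (_+ newCrossing k (suc h)) (trans (nth-insert-> _ bs (s≤s⁻¹ p<h+1))
                                                    (I.basement-height h (s≤s⁻¹ h<k+1))))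
            (sym (crossings-above {k} (s≤s⁻¹ p<h+1)))

  skip-ribbon : ∀ {k T} → (∀ g → newCrossing k g ≡ 0) → count2⁺12-top k ≡ 0 → DotPlaced k T →
                Invariant (suc k) T
  skip-ribbon {k} no-crossing no-shadow D = record
    { columns-length  = D.columns-length
    ; basement-length = D.basement-length
    ; basement-height = λ g g≤ → trans (sym (+-identityʳ _))
                                        (trans (cong (_ +_) (sym (no-crossing g))) (D.basement-height g g≤))
    ; special-last    = D.special-last
    ; shadow-total    = trans (sym (+-identityʳ _)) (trans (cong (_ +_) (sym no-shadow)) D.shadow-total)
    ; clear-total     = D.clear-total
    }
    where module D = DotPlaced D

  add-ribbon : ∀ {k p s cs bs sp} → p ≤ s → s ≤ k →
               (∀ g → newCrossing k g ≡ ⟦ inRange? p (suc s) g ⟧) → p + count2⁺12-top k ≡ s →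
               DotPlaced k (tableau cs bs sp) → Invariant (suc k) (addRibbon p s (tableau cs bs sp))
  add-ribbon {k} {p} {s} {cs} {bs} p≤s s≤k crossing-new shadows D = record
    { columns-length  = trans (length-mapBetween raiseColumn p s 0 cs) D.columns-length
    ; basement-length = trans (length-mapBetween suc p (suc s) 0 bs) D.basement-length
    ; basement-height = λ g g≤ → begin
        nth g (mapBetween suc p (suc s) 0 bs)  ≡⟨ nth-mapBetween-suc p (suc s) 0 g bs (g<length g≤) ⟩
        nth g bs + ⟦ inRange? p (suc s) g ⟧    ≡⟨ cong (nth g bs +_) (sym (crossing-new g)) ⟩
        nth g bs + newCrossing k g             ≡⟨ D.basement-height g g≤ ⟩
        crossings (suc k) g                    ∎
    ; special-last    = D.special-last
    ; shadow-total    = begin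
        sum (map dotRow (mapBetween raiseColumn p s 0 cs))
          ≡⟨ cong sum (map-mapBetween raiseColumn p s dotRow suc dotRow-raise 0 cs) ⟩
        sum (mapBetween suc p s 0 (map dotRow cs))
          ≡⟨ sum-mapBetween-suc p s 0 (map dotRow cs) z≤n s<length ⟩
        sum (map dotRow cs) + (s ∸ p)
          ≡⟨ cong (sum (map dotRow cs) +_) (trans (cong (_∸ p) (sym shadows)) (m+n∸m≡n p _)) ⟩
        sum (map dotRow cs) + count2⁺12-top k
          ≡⟨ D.shadow-total ⟩
        count2⁺12 (suc k) ∎
    ; clear-total     = trans (cong sum (map-mapBetween-invariant raiseColumn p s clearBoxes clearBoxes-raise 0 cs))
                              D.clear-total
    }
    where
    module D = DotPlaced D
    open ≡-Reasoning
    g<length : ∀ {g} → g ≤ suc k → g < length bs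
    g<length g≤ = subst (_ <_) (sym D.basement-length) (s≤s g≤)
    s<length : s < length (map dotRow cs)
    s<length = subst (s <_) (sym (trans (length-map dotRow cs) D.columns-length)) (s≤s s≤k)

  insertAt-invariant : ∀ {k T} → Invariant k T → Invariant (suc k) (insertAt T (rank k k))
  insertAt-invariant {zero} {tableau cs bs sp} I rewrite Invariant.special-last I =
    skip-ribbon (λ _ → refl) refl (place-dot I)
  insertAt-invariant {suc m} {tableau cs bs sp} I rewrite Invariant.special-last I =
    if-does (Invariant (suc (suc m))) (rank (suc m) (suc m) ≤? rank (suc m) m)
      (λ p≤s → add-ribbon p≤s (rank≤ (suc m) m) (newCrossing-ribbon m p≤s) (count2⁺12-top-ribbon m p≤s)
                          (place-dot I))
      (λ p≰s → skip-ribbon (newCrossing-none m p≰s) (count2⁺12-top-none m p≰s) (place-dot I))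

  insertions-invariant : ∀ m {k T} (g : Fin m → ℕ) → (∀ i → g i ≡ rank (k + toℕ i) (k + toℕ i)) →
                         Invariant k T → Invariant (k + m) (foldl insertAt T (tabulate g))
  insertions-invariant zero    {k} g _  I = subst (λ j → Invariant j _) (sym (+-identityʳ k)) I
  insertions-invariant (suc m) {k} {T} g hg I =
    subst (λ j → Invariant j (foldl insertAt (insertAt T (g F.zero)) (tabulate (g ∘ F.suc)))) (sym (+-suc k m))
      (insertions-invariant m (g ∘ F.suc) (λ i → trans (hg (F.suc i)) (cong (λ j → rank j j) (+-suc k (toℕ i))))
        (subst (λ x → Invariant (suc k) (insertAt T x)) (sym first-rank) (insertAt-invariant I)))
    where
    first-rank : g F.zero ≡ rank k k
    first-rank = trans (hg F.zero) (cong (λ j → rank j j) (+-identityʳ k))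

  Σ-left↔Fin-rank : ∀ k u → (Σ[ v ∈ ℕ ] (v < k × pos v < pos u)) ↔ Fin (rank k u)
  Σ-left↔Fin-rank k u = Σ<↔Fin∑ k λ v → ↔Fin⟦⟧ (pos v <? pos u) <-irrelevant

  ValuePattern2⁺12 : ℕ → Set
  ValuePattern2⁺12 k = Σ[ c ∈ ℕ ] (c < pred k × Σ[ b ∈ ℕ ] (b < c × (pos (suc c) < pos b × pos b < pos c)))

  ValuePattern1⁺21 : ℕ → Set
  ValuePattern1⁺21 k = Σ[ b ∈ ℕ ] (b < k × Σ[ c ∈ ℕ ] (c < pred b × (pos (suc c) < pos b × pos b < pos c)))

  ValuePattern2⁺12↔Fin : ∀ k → ValuePattern2⁺12 k ↔ Fin (count2⁺12 k)
  ValuePattern2⁺12↔Fin k = Σ<↔Fin∑ (pred k) λ c → Σ<↔Fin∑ c λ b →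
    ↔Fin⟦⟧ (inside? (suc c) c b) (×-irrelevant <-irrelevant <-irrelevant)

  ValuePattern1⁺21↔Fin : ∀ k → ValuePattern1⁺21 k ↔ Fin (count1⁺21 k)
  ValuePattern1⁺21↔Fin k = Σ<↔Fin∑ k λ b → Σ<↔Fin∑ (pred b) λ c →
    ↔Fin⟦⟧ (around? b c) (×-irrelevant <-irrelevant <-irrelevant)

-- Permutations as words

module _ {n} (σ : Permutation′ n) where

  private
    positionBy : ∀ v → Dec (v < n) → ℕ
    positionBy v (yes v<n) = toℕ (σ ⟨$⟩ˡ fromℕ< v<n)
    positionBy v (no _)    = v

  -- Values v ≥ n are sent to themselves, which keeps position injective on all of ℕ.
  position : ℕ → ℕ
  position v = positionBy v (v <? n)

  at : ∀ {v} → v < n → Fin n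
  at v<n = σ ⟨$⟩ˡ fromℕ< v<n

  toℕ-at : ∀ {v} (v<n : v < n) → toℕ (at v<n) ≡ position v
  toℕ-at {v} v<n = by (v <? n)
    where
    by : ∀ d → toℕ (at v<n) ≡ positionBy v d
    by (yes _)   = refl
    by (no v≮n)  = ⊥-elim (v≮n v<n)

  val-at : ∀ {v} (v<n : v < n) → val σ (at v<n) ≡ v
  val-at v<n = trans (cong toℕ (inverseʳ σ)) (FinP.toℕ-fromℕ< v<n)

  at-≡val : ∀ {i v} (v<n : v < n) → v ≡ val σ i → at v<n ≡ i
  at-≡val {i} v<n refl = trans (cong (σ ⟨$⟩ˡ_) (FinP.fromℕ<-toℕ _ v<n)) (inverseˡ σ)

  at-val : ∀ i → at (FinP.toℕ<n (σ ⟨$⟩ʳ i)) ≡ i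
  at-val i = at-≡val (FinP.toℕ<n (σ ⟨$⟩ʳ i)) refl

  position-val : ∀ i → position (val σ i) ≡ toℕ i
  position-val i = trans (sym (toℕ-at (FinP.toℕ<n (σ ⟨$⟩ʳ i)))) (cong toℕ (at-val i))

  position-toℕ : ∀ u → position (toℕ u) ≡ toℕ (σ ⟨$⟩ˡ u)
  position-toℕ u = trans (sym (toℕ-at u<n)) (cong (λ x → toℕ (σ ⟨$⟩ˡ x)) (FinP.fromℕ<-toℕ u u<n))
    where u<n = FinP.toℕ<n u

  position-injective : ∀ {u w} → position u ≡ position w → u ≡ w
  position-injective {u} {w} = by (u <? n) (w <? n)
    where
    by : ∀ d e → positionBy u d ≡ positionBy w e → u ≡ w
    by (yes u<n) (yes w<n) eq = FinP.fromℕ<-injective u w u<n w<n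
      (trans (sym (inverseʳ σ)) (trans (cong (σ ⟨$⟩ʳ_) (FinP.toℕ-injective eq)) (inverseʳ σ)))
    by (yes _)   (no w≮n)  eq = ⊥-elim (w≮n (subst (_< n) eq (FinP.toℕ<n _)))
    by (no u≮n)  (yes _)   eq = ⊥-elim (u≮n (subst (_< n) (sym eq) (FinP.toℕ<n _)))
    by (no _)    (no _)    eq = eq

  open Insertion position position-injective

  niAt≡rank : ∀ i → niAt σ i ≡ rank (toℕ i) (toℕ i)
  niAt≡rank i = ↔⇒≡ (↔-trans (↔-sym (Σ↔Fin-filter Earlier? Earlier-irrelevant (λ j → j)))
                             (↔-trans earlier↔left (Σ-left↔Fin-rank (toℕ i) (toℕ i))))
    where
    Earlier : Fin n → Set
    Earlier j = j F.< σ ⟨$⟩ˡ i × σ ⟨$⟩ʳ j F.< i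
    Earlier? : ∀ j → Dec (Earlier j)
    Earlier? j = (j F.<? σ ⟨$⟩ˡ i) ×-dec (σ ⟨$⟩ʳ j F.<? i)
    Earlier-irrelevant : ∀ {j} → Irrelevant (Earlier j)
    Earlier-irrelevant = ×-irrelevant <-irrelevant <-irrelevant
    earlier↔left : Σ (Fin n) Earlier ↔ (Σ[ v ∈ ℕ ] (v < toℕ i × position v < position (toℕ i)))
    earlier↔left = mk↔ₛ′ to from to∘from from∘to
      where
      to : Σ (Fin n) Earlier → Σ[ v ∈ ℕ ] (v < toℕ i × position v < position (toℕ i))
      to (j , j< , σj<) = val σ j , σj< , subst₂ _<_ (sym (position-val j)) (sym (position-toℕ i)) j<
      from : Σ[ v ∈ ℕ ] (v < toℕ i × position v < position (toℕ i)) → Σ (Fin n) Earlier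
      from (v , v<i , left) =
        at v<n , subst₂ _<_ (sym (toℕ-at v<n)) (position-toℕ i) left , subst (_< toℕ i) (sym (val-at v<n)) v<i
        where v<n = <-trans v<i (FinP.toℕ<n i)
      to∘from : ∀ y → to (from y) ≡ y
      to∘from (v , v<i , _) =
        Σ-≡-irrelevant (×-irrelevant <-irrelevant <-irrelevant) (val-at (<-trans v<i (FinP.toℕ<n i)))
      from∘to : ∀ x → from (to x) ≡ x
      from∘to (j , _) = Σ-≡-irrelevant Earlier-irrelevant (at-val j)

  private
    triple-irrelevant : ∀ {a b c d e f g h : ℕ} → Irrelevant (a < b × c < d × e ≡ suc f × g < h)
    triple-irrelevant = ×-irrelevant <-irrelevant (×-irrelevant <-irrelevant (×-irrelevant ≡-irrelevant <-irrelevant))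

    position-suc : ∀ {i k} → val σ i ≡ suc (val σ k) → position (suc (val σ k)) ≡ toℕ i
    position-suc {i} vi≡ = trans (cong position (sym vi≡)) (position-val i)

    adjacent-irrelevant : ∀ {b c} → Irrelevant (position (suc c) < position b × position b < position c)
    adjacent-irrelevant = ×-irrelevant <-irrelevant <-irrelevant

  Pattern2⁺12↔ValuePattern2⁺12 : Pattern2⁺12 σ ↔ ValuePattern2⁺12 n
  Pattern2⁺12↔ValuePattern2⁺12 = mk↔ₛ′ to from to∘from from∘to
    where
    to : Pattern2⁺12 σ → ValuePattern2⁺12 n
    to (i , j , k , i<j , j<k , vi≡ , vj<vk) =
      val σ k , pred-mono-≤ (subst (_< n) vi≡ (FinP.toℕ<n _)) , val σ j , vj<vk ,
      subst₂ _<_ (sym (position-suc vi≡)) (sym (position-val j)) i<j ,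
      subst₂ _<_ (sym (position-val j)) (sym (position-val k)) j<k
    from : ValuePattern2⁺12 n → Pattern2⁺12 σ
    from (c , c<n-1 , b , b<c , left , right) =
      at c+1<n , at b<n , at c<n ,
      subst₂ _<_ (sym (toℕ-at c+1<n)) (sym (toℕ-at b<n)) left ,
      subst₂ _<_ (sym (toℕ-at b<n)) (sym (toℕ-at c<n)) right ,
      trans (val-at c+1<n) (cong suc (sym (val-at c<n))) ,
      subst₂ _<_ (sym (val-at b<n)) (sym (val-at c<n)) b<c
      where
      c+1<n = <pred⇒suc< c<n-1
      c<n   = <-trans (n<1+n c) c+1<n
      b<n   = <-trans b<c c<n
    to∘from : ∀ t → to (from t) ≡ t
    to∘from (c , c<n-1 , b , b<c , _) = Σ²-≡ adjacent-irrelevant (val-at c<n) (val-at (<-trans b<c c<n))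
      where c<n = <-trans (n<1+n c) (<pred⇒suc< c<n-1)
    from∘to : ∀ x → from (to x) ≡ x
    from∘to (i , j , k , _ , _ , vi≡ , _) =
      Σ³-≡ triple-irrelevant (at-≡val (subst (_< n) vi≡ (FinP.toℕ<n _)) (sym vi≡)) (at-val j) (at-val k)

  Pattern1⁺21↔ValuePattern1⁺21 : Pattern1⁺21 σ ↔ ValuePattern1⁺21 n
  Pattern1⁺21↔ValuePattern1⁺21 = mk↔ₛ′ to from to∘from from∘to
    where
    to : Pattern1⁺21 σ → ValuePattern1⁺21 n
    to (i , j , k , i<j , j<k , vi≡ , vi<vj) =
      val σ j , FinP.toℕ<n _ , val σ k , pred-mono-≤ (subst (_< val σ j) vi≡ vi<vj) ,
      subst₂ _<_ (sym (position-suc vi≡)) (sym (position-val j)) i<j ,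
      subst₂ _<_ (sym (position-val j)) (sym (position-val k)) j<k
    from : ValuePattern1⁺21 n → Pattern1⁺21 σ
    from (b , b<n , c , c<b-1 , left , right) =
      at c+1<n , at b<n , at c<n ,
      subst₂ _<_ (sym (toℕ-at c+1<n)) (sym (toℕ-at b<n)) left ,
      subst₂ _<_ (sym (toℕ-at b<n)) (sym (toℕ-at c<n)) right ,
      trans (val-at c+1<n) (cong suc (sym (val-at c<n))) ,
      subst₂ _<_ (sym (val-at c+1<n)) (sym (val-at b<n)) c+1<b
      where
      c+1<b = <pred⇒suc< c<b-1
      c+1<n = <-trans c+1<b b<n
      c<n   = <-trans (n<1+n c) c+1<n
    to∘from : ∀ t → to (from t) ≡ t
    to∘from (b , b<n , c , c<b-1 , _) =
      Σ²-≡ adjacent-irrelevant (val-at b<n) (val-at (<-trans (n<1+n c) (<-trans (<pred⇒suc< c<b-1) b<n)))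
    from∘to : ∀ x → from (to x) ≡ x
    from∘to (i , j , k , _ , _ , vi≡ , _) =
      Σ³-≡ triple-irrelevant (at-≡val (subst (_< n) vi≡ (FinP.toℕ<n _)) (sym vi≡)) (at-val j) (at-val k)

-- Boxes of a tableau

ShadowBox↔Fin : ∀ T → ShadowBox T ↔ Fin (sum (map dotRow (columns T)))
ShadowBox↔Fin T = Σ-lookup↔Fin-sum (λ c → Σ<↔Fin (dotRow c)) (columns T)

ClearBox↔Fin : ∀ T → ClearBox T ↔ Fin (sum (map clearBoxes (columns T)))
ClearBox↔Fin T = Σ-lookup↔Fin-sum (λ c → Σ-between↔Fin (dotRow c) (height c)) (columns T)

equinumerous⇒⤖ : ∀ {A B : Set} {m m′} → A ↔ Fin m → m ≡ m′ → B ↔ Fin m′ → A ⤖ B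
equinumerous⇒⤖ A↔ refl B↔ = ↔⇒⤖ (↔-trans A↔ (↔-sym B↔))

proposition9 : (n : ℕ) (c : List ℕ) → IsInsertionSequence c →
               (σ : Permutation′ n) → nonInversionTable σ ≡ c →
               (ShadowBox (build c) ⤖ Pattern2⁺12 σ) × (ClearBox (build c) ⤖ Pattern1⁺21 σ)
proposition9 n _ _ σ refl =
    equinumerous⇒⤖ (ShadowBox↔Fin T) (Invariant.shadow-total I)
      (↔-trans (Pattern2⁺12↔ValuePattern2⁺12 σ) (ValuePattern2⁺12↔Fin n))
  , equinumerous⇒⤖ (ClearBox↔Fin T) (Invariant.clear-total I)
      (↔-trans (Pattern1⁺21↔ValuePattern1⁺21 σ) (ValuePattern1⁺21↔Fin n))
  where
  open Insertion (position σ) (position-injective σ)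
  T = build (nonInversionTable σ)
  I : Invariant n T
  I = subst (Invariant n ∘ build) (sym (map-tabulate (λ i → i) (niAt σ)))
        (insertions-invariant n (niAt σ) (niAt≡rank σ) emptyTableau-invariant)
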